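{- Let $A=(B,\hat{B},\iota)$ be an arch. Suppose that $\hat{B}$ satisfies {\bf(sur)}, and that $B$ admits an elimination $\epsilon$. Let $I\neq\emptyset$ and $R_{i}\subseteq\hat{L}_{1}$, for $i\in I$. Then $$(T_{2}\cup\iota(\bigcap_{i\in I}(T_1\cup R_i)_{{L}_{1}}))_{L_{2}} = (T_{2}\cup\iota(\bigcap_{i\in I}(T_1\cup R_i)_{\hat{L}_{1}}))_{L_{2}} = \bigcap_{i\in I}(T_{2}\cup\iota R_{i})_{L_{2}}.$$ In particular, $(T_{2}\cup\iota((T_{1}\cup R)_{L_{1}}))_{L_{2}} = (T_{2}\cup\iota((T_{1}\cup R)_{\hat{L}_{1}}))_{L_{2}} = (T_{2}\cup\iota R)_{L_{2}}$ for every $R\subseteq\hat{L}_{1}$.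
   Context: Languages $\mathfrak{L}_1,\mathfrak{L}_2$ are first-order (possibly multi-sorted). An $\mathfrak{L}$-fragment is a set of $\mathfrak{L}$-sentences containing $\top,\perp$ and closed under $\wedge,\vee$; for a theory $T$ and fragment $L$, $T_L=T^\vdash\cap L$ ($T^\vdash$ the deductive closure). A bridge $B=(C_1,C_2,\sigma)$ consists of contexts $C_i=(L_i,T_i)$ ($L_i$ an $\mathfrak{L}_i$-fragment, $T_i$ an $\mathfrak{L}_i$-theory) and a class function $\sigma:\mathrm{Mod}(T_2)\to\mathrm{Mod}(T_1)$. An interpretation for $B$ is a map $\iota:L_1\to L_2$ with $\sigma M\models\varphi\iff M\models\iota\varphi$ for all $\varphi\in L_1$, $M\models T_2$; an elimination is a map $\epsilon:L_2\to L_1$ with $\sigma M\models\epsilon\psi\iff M\models\psi$ for all $\psi\in L_2$, $M\models T_2$. $B$ satisfies {\bf(sur)} if for every $N\models T_1$ there is $M\models T_2$ with $\mathrm{Th}_{L_1}(N)=\mathrm{Th}_{L_1}(\sigma M)$. An arch is a triple $(B,\hat{B},\iota)$ where $\hat{B}=((\hat{L}_1,T_1),(\hat{L}_2,T_2),\sigma)$ with $L_i\subseteq\hat{L}_i$ (a fragment extension of $B$ with the same theories and $\sigma$), $\iota$ is an interpretation for $\hat{B}$, and $\iota|_{L_1}$ is an interpretation for $B$. -}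

module Defs where

open import Level using (Level; _⊔_; 0ℓ; Lift) renaming (suc to lsuc)
open import Data.List using (List; []; _∷_)
open import Data.List.Membership.Propositional using (_∈_)
open import Data.List.Relation.Unary.All as All using (All)
open import Data.Product using (Σ; Σ-syntax; _×_; proj₁)
open import Data.Sum using (_⊎_)
open import Data.Empty using (⊥)
open import Data.Unit using (⊤)
open import Relation.Nullary using (¬_)
open import Relation.Binary.PropositionalEquality using (_≡_)
open import Relation.Unary using (Pred; _⊆_; _∪_; _∩_)
open import Function.Bundles using (_⇔_)

record Signature : Set₁ where
  field
    Sort : Set
    Fun  : List Sort → Sort → Set
    Rel  : List Sort → Set

module _ (𝔏 : Signature) where
  open Signature 𝔏

  mutual
    data Term (Γ : List Sort) : Sort → Set where
      var : ∀ {s} → s ∈ Γ → Term Γ s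
      app : ∀ {ss s} → Fun ss s → Terms Γ ss → Term Γ s

    data Terms (Γ : List Sort) : List Sort → Set where
      []  : Terms Γ []
      _∷_ : ∀ {s ss} → Term Γ s → Terms Γ ss → Terms Γ (s ∷ ss)

  data Formula (Γ : List Sort) : Set where
    rel       : ∀ {ss} → Rel ss → Terms Γ ss → Formula Γ
    equ       : ∀ {s} → Term Γ s → Term Γ s → Formula Γ
    ⊤f ⊥f     : Formula Γ
    ¬f        : Formula Γ → Formula Γ
    _∧f_ _∨f_ _⇒f_ : Formula Γ → Formula Γ → Formula Γ
    ∀f ∃f     : (s : Sort) → Formula (s ∷ Γ) → Formula Γ

  Sentence : Set
  Sentence = Formula []

  SentSet : Set₁
  SentSet = Pred Sentence 0ℓ

record Structure (𝔏 : Signature) (ℓ : Level) : Set (lsuc ℓ) where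
  open Signature 𝔏
  field
    Carrier : Sort → Set ℓ
    funI    : ∀ {ss s} → Fun ss s → All Carrier ss → Carrier s
    relI    : ∀ {ss} → Rel ss → All Carrier ss → Set ℓ

module Semantics {𝔏 : Signature} {ℓ : Level} (M : Structure 𝔏 ℓ) where
  open Signature 𝔏
  open Structure M

  mutual
    evalT : ∀ {Γ s} → Term 𝔏 Γ s → All Carrier Γ → Carrier s
    evalT (var x)    ρ = All.lookup ρ x
    evalT (app f ts) ρ = funI f (evalTs ts ρ)

    evalTs : ∀ {Γ ss} → Terms 𝔏 Γ ss → All Carrier Γ → All Carrier ss
    evalTs []       ρ = All.[]
    evalTs (t ∷ ts) ρ = evalT t ρ All.∷ evalTs ts ρ

  sat : ∀ {Γ} → Formula 𝔏 Γ → All Carrier Γ → Set ℓ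
  sat (rel r ts) ρ = relI r (evalTs ts ρ)
  sat (equ t u)  ρ = evalT t ρ ≡ evalT u ρ
  sat ⊤f         ρ = Lift ℓ ⊤
  sat ⊥f         ρ = Lift ℓ ⊥
  sat (¬f φ)     ρ = ¬ sat φ ρ
  sat (φ ∧f ψ)   ρ = sat φ ρ × sat ψ ρ
  sat (φ ∨f ψ)   ρ = sat φ ρ ⊎ sat ψ ρ
  sat (φ ⇒f ψ)   ρ = sat φ ρ → sat ψ ρ
  sat (∀f s φ)   ρ = (a : Carrier s) → sat φ (a All.∷ ρ)
  sat (∃f s φ)   ρ = Σ[ a ∈ Carrier s ] sat φ (a All.∷ ρ)

_⊨_ : ∀ {𝔏 ℓ} → Structure 𝔏 ℓ → Sentence 𝔏 → Set ℓ
M ⊨ φ = Semantics.sat M φ All.[]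

_⊨ₜ_ : ∀ {𝔏 ℓ a} → Structure 𝔏 ℓ → Pred (Sentence 𝔏) a → Set (ℓ ⊔ a)
M ⊨ₜ T = ∀ {φ} → T φ → M ⊨ φ

-- Deductive closure T^⊢ (as consequence w.r.t. all models with carriers
-- in universe ℓ) and T_L = T^⊢ ∩ L.

Cn : ∀ {𝔏} (ℓ : Level) {a} → Pred (Sentence 𝔏) a → Pred (Sentence 𝔏) (lsuc ℓ ⊔ a)
Cn {𝔏} ℓ T φ = (M : Structure 𝔏 ℓ) → M ⊨ₜ T → M ⊨ φ

Restr : ∀ {𝔏} (ℓ : Level) {a} → Pred (Sentence 𝔏) a → SentSet 𝔏 → Pred (Sentence 𝔏) (lsuc ℓ ⊔ a)
Restr ℓ T L = Cn ℓ T ∩ L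

record IsFragment {𝔏 : Signature} (L : SentSet 𝔏) : Set where
  field
    has-⊤ : L ⊤f
    has-⊥ : L ⊥f
    ∧-closed : ∀ {φ ψ} → L φ → L ψ → L (φ ∧f ψ)
    ∨-closed : ∀ {φ ψ} → L φ → L ψ → L (φ ∨f ψ)

record Context (𝔏 : Signature) : Set₁ where
  field
    L      : SentSet 𝔏
    L-frag : IsFragment L
    T      : SentSet 𝔏

record Bridge (ℓ : Level) (𝔏₁ 𝔏₂ : Signature) : Set (lsuc (lsuc ℓ)) where
  field
    C₁ : Context 𝔏₁
    C₂ : Context 𝔏₂
  open Context C₁ public renaming (L to L₁; L-frag to L₁-frag; T to T₁)
  open Context C₂ public renaming (L to L₂; L-frag to L₂-frag; T to T₂)
  field
    σ     : (M : Structure 𝔏₂ ℓ) → M ⊨ₜ T₂ → Structure 𝔏₁ ℓ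
    σ-mod : (M : Structure 𝔏₂ ℓ) (h : M ⊨ₜ T₂) → σ M h ⊨ₜ T₁

FragMap : ∀ {𝔏 𝔏'} → SentSet 𝔏 → SentSet 𝔏' → Set
FragMap {𝔏} {𝔏'} L L' = (φ : Sentence 𝔏) → L φ → Σ[ ψ ∈ Sentence 𝔏' ] L' ψ

module _ {ℓ 𝔏₁ 𝔏₂} (B : Bridge ℓ 𝔏₁ 𝔏₂) where
  open Bridge B

  IsInterpretation : FragMap L₁ L₂ → Set (lsuc ℓ)
  IsInterpretation ι = ∀ φ (p : L₁ φ) (M : Structure 𝔏₂ ℓ) (h : M ⊨ₜ T₂) →
    (σ M h ⊨ φ) ⇔ (M ⊨ proj₁ (ι φ p))

  IsElimination : FragMap L₂ L₁ → Set (lsuc ℓ)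
  IsElimination ε = ∀ ψ (q : L₂ ψ) (M : Structure 𝔏₂ ℓ) (h : M ⊨ₜ T₂) →
    (σ M h ⊨ proj₁ (ε ψ q)) ⇔ (M ⊨ ψ)

  Sur : Set (lsuc ℓ)
  Sur = (N : Structure 𝔏₁ ℓ) → N ⊨ₜ T₁ →
    Σ[ M ∈ Structure 𝔏₂ ℓ ] Σ[ h ∈ M ⊨ₜ T₂ ]
      (∀ φ → L₁ φ → (N ⊨ φ) ⇔ (σ M h ⊨ φ))

extend : ∀ {ℓ 𝔏₁ 𝔏₂} (B : Bridge ℓ 𝔏₁ 𝔏₂) (L̂₁ : SentSet 𝔏₁) (L̂₂ : SentSet 𝔏₂) →
  IsFragment L̂₁ → IsFragment L̂₂ → Bridge ℓ 𝔏₁ 𝔏₂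
extend B L̂₁ L̂₂ f₁ f₂ = record
  { C₁ = record { L = L̂₁ ; L-frag = f₁ ; T = Bridge.T₁ B }
  ; C₂ = record { L = L̂₂ ; L-frag = f₂ ; T = Bridge.T₂ B }
  ; σ = Bridge.σ B
  ; σ-mod = Bridge.σ-mod B }

record Arch (ℓ : Level) (𝔏₁ 𝔏₂ : Signature) : Set (lsuc (lsuc ℓ)) where
  field
    B : Bridge ℓ 𝔏₁ 𝔏₂
  open Bridge B public
  field
    L̂₁ : SentSet 𝔏₁
    L̂₂ : SentSet 𝔏₂
    L̂₁-frag : IsFragment L̂₁
    L̂₂-frag : IsFragment L̂₂
    L₁⊆L̂₁ : L₁ ⊆ L̂₁
    L₂⊆L̂₂ : L₂ ⊆ L̂₂

  B̂ : Bridge ℓ 𝔏₁ 𝔏₂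
  B̂ = extend B L̂₁ L̂₂ L̂₁-frag L̂₂-frag

  field
    ι : FragMap L̂₁ L̂₂
    ι-interp : IsInterpretation B̂ ι
    ι-restr-L₂ : ∀ φ (q : L₁ φ) → L₂ (proj₁ (ι φ (L₁⊆L̂₁ q)))

  ι∣L₁ : FragMap L₁ L₂
  ι∣L₁ φ q = proj₁ (ι φ (L₁⊆L̂₁ q)) Data.Product., ι-restr-L₂ φ q

  field
    ι∣L₁-interp : IsInterpretation B ι∣L₁

  ιImg : ∀ {a} → Pred (Sentence 𝔏₁) a → Pred (Sentence 𝔏₂) a
  ιImg S ψ = Σ[ φ ∈ Sentence 𝔏₁ ] Σ[ p ∈ L̂₁ φ ] (S φ × ψ ≡ proj₁ (ι φ p))

{-# OPTIONS --safe #-}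
module Submission where

open import Defs
open import Level using (Level; _⊔_) renaming (suc to lsuc)
open import Data.Product using (_×_; _,_; proj₁; proj₂)
open import Data.Sum using (inj₁; inj₂)
open import Relation.Unary using (Pred; _⊆_; _≐_; _∪_; ⋂)
open import Relation.Binary.PropositionalEquality using (refl)
open import Function.Bundles using (Equivalence)
open Equivalence using (to; from)

-- A model M ⊨ T₂ satisfies ι S exactly when σ M satisfies S, so
-- ι-images of consequences of T₁ ∪ R are already consequences of T₂ ∪ ι R.
-- Conversely, if T₂ ∪ ι R proves ψ ∈ L₂, then T₁ ∪ R proves ε ψ ∈ L₁: every
-- model N of T₁ ∪ R agrees on L̂₁ with some σ M by (sur), and such an M
-- satisfies T₂ ∪ ι R, hence ψ, hence σ M ⊨ ε ψ.  Since ε ψ is then in each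
-- (T₁ ∪ Rᵢ)_{L₁} and ι (ε ψ) is equivalent to ψ modulo T₂, the three
-- theories coincide; I ≠ ∅ is needed only to know that a ψ in the
-- intersection lies in L₂.

cycle⇒≐ : ∀ {a} {A : Set a} {ℓ₁ ℓ₂ ℓ₃} {P : Pred A ℓ₁} {Q : Pred A ℓ₂} {R : Pred A ℓ₃} →
  P ⊆ Q → Q ⊆ R → R ⊆ P → (P ≐ Q) × (Q ≐ R)
cycle⇒≐ P⊆Q Q⊆R R⊆P = (P⊆Q , λ x → R⊆P (Q⊆R x)) , (Q⊆R , λ x → P⊆Q (R⊆P x))

Cn-trans : ∀ {𝔏 ℓ a b} {T : Pred (Sentence 𝔏) a} {T′ : Pred (Sentence 𝔏) b} →
  T ⊆ Cn ℓ T′ → Cn ℓ T ⊆ Cn ℓ T′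
Cn-trans T⊆CnT′ φ∈CnT M M⊨T′ = φ∈CnT M (λ t → T⊆CnT′ t M M⊨T′)

module ArchProperties {ℓ : Level} {𝔏₁ 𝔏₂ : Signature} (A : Arch ℓ 𝔏₁ 𝔏₂) where
  open Arch A

  ιTheory : ∀ {a} → Pred (Sentence 𝔏₁) a → Pred (Sentence 𝔏₂) (lsuc ℓ ⊔ a)
  ιTheory S = Restr ℓ (T₂ ∪ ιImg S) L₂

  ιImg-mono : ∀ {a b} {S : Pred (Sentence 𝔏₁) a} {S′ : Pred (Sentence 𝔏₁) b} →
    S ⊆ S′ → ιImg S ⊆ ιImg S′
  ιImg-mono S⊆S′ (φ , p , φ∈S , eq) = φ , p , S⊆S′ φ∈S , eq

  ιImg-⊨ : ∀ {a} {S : Pred (Sentence 𝔏₁) a} (M : Structure 𝔏₂ ℓ) (h : M ⊨ₜ T₂) →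
    σ M h ⊨ₜ S → M ⊨ₜ ιImg S
  ιImg-⊨ M h σM⊨S (φ , p , φ∈S , refl) = to (ι-interp φ p M h) (σM⊨S φ∈S)

  σ-⊨-ιImg : ∀ {R : SentSet 𝔏₁} → R ⊆ L̂₁ → (M : Structure 𝔏₂ ℓ) (h : M ⊨ₜ T₂) →
    M ⊨ₜ ιImg R → σ M h ⊨ₜ R
  σ-⊨-ιImg R⊆L̂₁ M h M⊨ιR {φ} φ∈R =
    from (ι-interp φ (R⊆L̂₁ φ∈R) M h) (M⊨ιR (φ , R⊆L̂₁ φ∈R , φ∈R , refl))

  σ-⊨-T₁∪R : ∀ {R : SentSet 𝔏₁} → R ⊆ L̂₁ → (M : Structure 𝔏₂ ℓ) (h : M ⊨ₜ (T₂ ∪ ιImg R)) →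
    σ M (λ t → h (inj₁ t)) ⊨ₜ (T₁ ∪ R)
  σ-⊨-T₁∪R R⊆L̂₁ M h (inj₁ t)   = σ-mod M (λ t → h (inj₁ t)) t
  σ-⊨-T₁∪R R⊆L̂₁ M h (inj₂ φ∈R) = σ-⊨-ιImg R⊆L̂₁ M (λ t → h (inj₁ t)) (λ r → h (inj₂ r)) φ∈R

  ιImg-Cn : ∀ {a} {S : Pred (Sentence 𝔏₁) a} {R : SentSet 𝔏₁} → R ⊆ L̂₁ →
    S ⊆ Cn ℓ (T₁ ∪ R) → ιImg S ⊆ Cn ℓ (T₂ ∪ ιImg R)
  ιImg-Cn R⊆L̂₁ S⊆Cn ιφ∈ιS M h =
    ιImg-⊨ M (λ t → h (inj₁ t)) (λ φ∈S → S⊆Cn φ∈S _ (σ-⊨-T₁∪R R⊆L̂₁ M h)) ιφ∈ιS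

  ιTheory-⊆ : ∀ {a b} {S : Pred (Sentence 𝔏₁) a} {S′ : Pred (Sentence 𝔏₁) b} →
    ιImg S ⊆ Cn ℓ (T₂ ∪ ιImg S′) → ιTheory S ⊆ ιTheory S′
  ιTheory-⊆ {S = S} {S′} ιS⊆Cn {ψ} (ψ∈Cn , ψ∈L₂) =
    Cn-trans {T = T₂ ∪ ιImg S} {T′ = T₂ ∪ ιImg S′}
      (λ { (inj₁ t) M h → h (inj₁ t) ; (inj₂ ιφ) → ιS⊆Cn ιφ }) {ψ} ψ∈Cn
    , ψ∈L₂

  ιTheory-mono : ∀ {a b} {S : Pred (Sentence 𝔏₁) a} {S′ : Pred (Sentence 𝔏₁) b} →
    S ⊆ S′ → ιTheory S ⊆ ιTheory S′
  ιTheory-mono S⊆S′ = ιTheory-⊆ (λ ιφ M h → h (inj₂ (ιImg-mono S⊆S′ ιφ)))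

  ιTheory-mono-Cn : ∀ {a} {S : Pred (Sentence 𝔏₁) a} {R : SentSet 𝔏₁} → R ⊆ L̂₁ →
    S ⊆ Cn ℓ (T₁ ∪ R) → ιTheory S ⊆ ιTheory R
  ιTheory-mono-Cn R⊆L̂₁ S⊆Cn = ιTheory-⊆ (ιImg-Cn R⊆L̂₁ S⊆Cn)

  module _ {I : Set} (R : I → SentSet 𝔏₁) where

    ιTheory-⋂-L₁⊆L̂₁ : ιTheory (⋂ I (λ i → Restr ℓ (T₁ ∪ R i) L₁))
                    ⊆ ιTheory (⋂ I (λ i → Restr ℓ (T₁ ∪ R i) L̂₁))
    ιTheory-⋂-L₁⊆L̂₁ = ιTheory-mono (λ φ∈⋂ i → proj₁ (φ∈⋂ i) , L₁⊆L̂₁ (proj₂ (φ∈⋂ i)))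

    ιTheory-⋂⊆⋂-ιTheory : (∀ i → R i ⊆ L̂₁) →
      ιTheory (⋂ I (λ i → Restr ℓ (T₁ ∪ R i) L̂₁)) ⊆ ⋂ I (λ i → ιTheory (R i))
    ιTheory-⋂⊆⋂-ιTheory R⊆L̂₁ ψ∈ i = ιTheory-mono-Cn (R⊆L̂₁ i) (λ φ∈⋂ → proj₁ (φ∈⋂ i)) ψ∈

  module _ (ε : FragMap L₂ L₁) (ε-elim : IsElimination B ε) where

    ιTheory-from-ε : ∀ {a} {S : Pred (Sentence 𝔏₁) a} {ψ} (q : L₂ ψ) →
      S (proj₁ (ε ψ q)) → ιTheory S ψ
    ιTheory-from-ε {ψ = ψ} q εψ∈S = (λ M h →
        to (ε-elim ψ q M (λ t → h (inj₁ t)))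
          (from (ι-interp _ εψ∈L̂₁ M (λ t → h (inj₁ t))) (h (inj₂ (_ , εψ∈L̂₁ , εψ∈S , refl)))))
      , q
      where
      εψ∈L̂₁ : L̂₁ (proj₁ (ε ψ q))
      εψ∈L̂₁ = L₁⊆L̂₁ (proj₂ (ε ψ q))

    module _ (sur : Sur B̂) where

      ε-transfers-Cn : ∀ {R : SentSet 𝔏₁} → R ⊆ L̂₁ → ∀ {ψ} → Cn ℓ (T₂ ∪ ιImg R) ψ →
        (q : L₂ ψ) → Restr ℓ (T₁ ∪ R) L₁ (proj₁ (ε ψ q))
      ε-transfers-Cn {R} R⊆L̂₁ {ψ} ψ∈Cn q = εψ∈Cn , εψ∈L₁
        where
        εψ∈L₁ : L₁ (proj₁ (ε ψ q))
        εψ∈L₁ = proj₂ (ε ψ q)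
        εψ∈Cn : Cn ℓ (T₁ ∪ R) (proj₁ (ε ψ q))
        εψ∈Cn N N⊨T₁∪R with sur N (λ t → N⊨T₁∪R (inj₁ t))
        ... | M , M⊨T₂ , N≡σM =
          from (N≡σM _ (L₁⊆L̂₁ εψ∈L₁)) (from (ε-elim ψ q M M⊨T₂) (ψ∈Cn M M⊨T₂∪ιR))
          where
          M⊨T₂∪ιR : M ⊨ₜ (T₂ ∪ ιImg R)
          M⊨T₂∪ιR (inj₁ t)  = M⊨T₂ t
          M⊨T₂∪ιR (inj₂ ιφ) =
            ιImg-⊨ M M⊨T₂ (λ {φ} φ∈R → to (N≡σM φ (R⊆L̂₁ φ∈R)) (N⊨T₁∪R (inj₂ φ∈R))) ιφ

      ιTheory⊆ιTheory-Restr : ∀ {R : SentSet 𝔏₁} → R ⊆ L̂₁ →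
        ιTheory R ⊆ ιTheory (Restr ℓ (T₁ ∪ R) L₁)
      ιTheory⊆ιTheory-Restr R⊆L̂₁ (ψ∈Cn , q) = ιTheory-from-ε q (ε-transfers-Cn R⊆L̂₁ ψ∈Cn q)

      ⋂-ιTheory⊆ιTheory-⋂ : ∀ {I : Set} (R : I → SentSet 𝔏₁) → I → (∀ i → R i ⊆ L̂₁) →
        ⋂ I (λ i → ιTheory (R i)) ⊆ ιTheory (⋂ I (λ i → Restr ℓ (T₁ ∪ R i) L₁))
      ⋂-ιTheory⊆ιTheory-⋂ R i₀ R⊆L̂₁ {ψ} ψ∈⋂ =
        ιTheory-from-ε q (λ i → ε-transfers-Cn (R⊆L̂₁ i) (proj₁ (ψ∈⋂ i)) q)
        where
        q : L₂ ψ
        q = proj₂ (ψ∈⋂ i₀)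

proposition2p24 : ∀ {ℓ : Level} {𝔏₁ 𝔏₂ : Signature} (A : Arch ℓ 𝔏₁ 𝔏₂) →
    let open Arch A in
    Sur B̂ →
    (ε : FragMap L₂ L₁) → IsElimination B ε →
    ((I : Set) → I → (R : I → SentSet 𝔏₁) → (∀ i → R i ⊆ L̂₁) →
      (Restr ℓ (T₂ ∪ ιImg (⋂ I (λ i → Restr ℓ (T₁ ∪ R i) L₁))) L₂
        ≐ Restr ℓ (T₂ ∪ ιImg (⋂ I (λ i → Restr ℓ (T₁ ∪ R i) L̂₁))) L₂)
      × (Restr ℓ (T₂ ∪ ιImg (⋂ I (λ i → Restr ℓ (T₁ ∪ R i) L̂₁))) L₂
        ≐ ⋂ I (λ i → Restr ℓ (T₂ ∪ ιImg (R i)) L₂)))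
    × ((R : SentSet 𝔏₁) → R ⊆ L̂₁ →
      (Restr ℓ (T₂ ∪ ιImg (Restr ℓ (T₁ ∪ R) L₁)) L₂
        ≐ Restr ℓ (T₂ ∪ ιImg (Restr ℓ (T₁ ∪ R) L̂₁)) L₂)
      × (Restr ℓ (T₂ ∪ ιImg (Restr ℓ (T₁ ∪ R) L̂₁)) L₂
        ≐ Restr ℓ (T₂ ∪ ιImg R) L₂))
proposition2p24 A sur ε ε-elim =
    (λ I i₀ R R⊆L̂₁ → cycle⇒≐
      (ιTheory-⋂-L₁⊆L̂₁ R)
      (ιTheory-⋂⊆⋂-ιTheory R R⊆L̂₁)
      (⋂-ιTheory⊆ιTheory-⋂ ε ε-elim sur R i₀ R⊆L̂₁))
  , (λ R R⊆L̂₁ → cycle⇒≐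
      (ιTheory-mono (λ (φ∈Cn , φ∈L₁) → φ∈Cn , L₁⊆L̂₁ φ∈L₁))
      (ιTheory-mono-Cn R⊆L̂₁ (λ φ∈S → proj₁ φ∈S))
      (ιTheory⊆ιTheory-Restr ε ε-elim sur R⊆L̂₁))
  where
  open Arch A
  open ArchProperties A
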